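{- Let $m$ be a positive integer. Then, for $0\le i,j\le m$: (1) the change of basis matrix from $\mathbf{H}^{\blacktriangle}_m$ to $\mathbf{F}^{\blacktriangledown}_m$ has $(i,j)$th entry $(-1)^{m-j}\sum_{s=\max\{m-i,m-j\}}^{m}\binom{i}{m-s}\binom{s}{m-j}$; (2) the change of basis matrix from $\mathbf{F}^{\blacktriangledown}_m$ to $\mathbf{H}^{\blacktriangle}_m$ has $(i,j)$th entry $(-1)^{m-j}\sum_{s=0}^{\min\{m-i,m-j\}}\binom{m-i}{s}\binom{m-s}{j}$; (3) the change of basis matrix from $\mathbf{H}^{\bullet}_m$ to $\mathbf{F}^{\blacktriangle}_m$ has $(i,j)$th entry $\sum_{s=0}^{\min\{i,j\}}\binom{i}{s}\binom{m-s}{m-j}$; (4) the change of basis matrix from $\mathbf{F}^{\blacktriangle}_m$ to $\mathbf{H}^{\bullet}_m$ has $(i,j)$th entry $(-1)^{i+j}\sum_{s=\max\{i,j\}}^{m}\binom{m-i}{m-s}\binom{s}{j}$.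
   Context: All vectors are row vectors in $\mathbb{R}^{m+1}$ with components indexed $0,\dots,m$; matrices have rows and columns indexed from $0$. Binomial coefficients $\binom{a}{b}$ with $a\ge0$ are $0$ when $b<0$ or $b>a$. Bases of $\mathbb{R}^{m+1}$, each consisting of vectors indexed by $i=0,\dots,m$, with $j$th component given: $\mathbf{H}^{\bullet}_m$: $\vartheta^{\bullet}(i;m)_j=(-1)^{j-i}\binom{m-i}{j-i}$; $\mathbf{F}^{\blacktriangle}_m$: $\varphi^{\blacktriangle}(i;m)_j=\binom{i}{j}$; $\mathbf{H}^{\blacktriangle}_m$: $\vartheta^{\blacktriangle}(i;m)_j=(-1)^j\binom{m-i}{j}$; $\mathbf{F}^{\blacktriangledown}_m$: $\varphi^{\blacktriangledown}(i;m)_j=\binom{i}{m-j}$. The change of basis matrix from a basis $\mathfrak{B}=(b_0,\dots,b_m)$ to a basis $\mathfrak{B}'=(b'_0,\dots,b'_m)$ is the matrix whose $i$th row is the coordinate vector of $b'_i$ with respect to $\mathfrak{B}$, i.e. the unique $(\kappa_0,\dots,\kappa_m)$ with $\sum_k\kappa_kb_k=b'_i$.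
   Formalization: All vectors, including the coordinate vectors whose uniqueness defines each change of basis matrix, are taken in ℚ^(m+1) instead of ℝ^(m+1). -}

module Defs where

open import Data.Nat using (ℕ; zero; suc; _∸_)
open import Data.Nat.Combinatorics using (_C_)
open import Data.Integer using (ℤ; +_; -[1+_])
import Data.Integer
open import Data.Rational using (ℚ; 0ℚ; 1ℚ; -_; _+_; _*_; _/_)
open import Data.Fin using (Fin; toℕ)
import Data.Fin as Fin
open import Data.Product using (_×_)
open import Relation.Binary.PropositionalEquality using (_≡_)

ℕ→ℚ : ℕ → ℚ
ℕ→ℚ n = (+ n) / 1

-- (-1)^z for an integer exponent z
sgn : ℤ → ℚ
sgn (+ zero) = 1ℚ
sgn (+ suc n) = - sgn (+ n)
sgn -[1+ zero ] = - 1ℚ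
sgn -[1+ suc n ] = - sgn -[1+ n ]

-- binomial coefficient (a choose b) for a ≥ 0 and integer b; 0 if b < 0 or b > a
binom : ℕ → ℤ → ℚ
binom a (+ b) = ℕ→ℚ (a C b)
binom a -[1+ _ ] = 0ℚ

ι : ℕ → ℤ
ι n = + n

sumFrom : ℕ → ℕ → (ℕ → ℚ) → ℚ
sumFrom a zero f = 0ℚ
sumFrom a (suc n) f = f a + sumFrom (suc a) n f

-- Σ_{s = a}^{b} f s   (empty sum, = 0, when a > b)
sumRange : ℕ → ℕ → (ℕ → ℚ) → ℚ
sumRange a b f = sumFrom a (suc b ∸ a) f

ΣFin : ∀ {n} → (Fin n → ℚ) → ℚ
ΣFin {zero} f = 0ℚ
ΣFin {suc n} f = f Fin.zero + ΣFin (λ k → f (Fin.suc k))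

-- vectors of ℝ^{m+1} (here with rational entries), components indexed 0..m
Vect : ℕ → Set
Vect m = Fin (suc m) → ℚ

Family : ℕ → Set
Family m = Fin (suc m) → Vect m

lincomb : ∀ {m} → (Fin (suc m) → ℚ) → Family m → Vect m
lincomb κ b j = ΣFin (λ k → κ k * b k j)

IsCoords : ∀ {m} → Family m → Vect m → (Fin (suc m) → ℚ) → Set
IsCoords b v κ = ∀ j → lincomb κ b j ≡ v j

UniqueCoords : ∀ {m} → Family m → Vect m → (Fin (suc m) → ℚ) → Set
UniqueCoords b v κ = IsCoords b v κ × (∀ κ′ → IsCoords b v κ′ → ∀ k → κ′ k ≡ κ k)

-- M is the change of basis matrix from B to B′:
-- its i-th row is the coordinate vector of B′ i with respect to B
IsChangeOfBasis : ∀ {m} → Family m → Family m → (Fin (suc m) → Fin (suc m) → ℚ) → Set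
IsChangeOfBasis B B′ M = ∀ i → UniqueCoords B (B′ i) (M i)

Hbullet : (m : ℕ) → Family m
Hbullet m i j = sgn (ι (toℕ j) Data.Integer.- ι (toℕ i)) * binom (m ∸ toℕ i) (ι (toℕ j) Data.Integer.- ι (toℕ i))

Fup : (m : ℕ) → Family m
Fup m i j = binom (toℕ i) (ι (toℕ j))

Hup : (m : ℕ) → Family m
Hup m i j = sgn (ι (toℕ j)) * binom (m ∸ toℕ i) (ι (toℕ j))

Fdown : (m : ℕ) → Family m
Fdown m i j = binom (toℕ i) (ι m Data.Integer.- ι (toℕ j))

-- Write P for the Pascal matrix (C(i,j)), D for diag((-1)^j) and J for the exchange
-- matrix reversing the order of coordinates.  Binomial inversion says that Q = P D is an
-- involution, hence P⁻¹ = D Q.  The four bases are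
--   F▲ = P,   F▼ = P J,   H▲ = J Q,   H• = J P⁻¹ J,
-- so each is invertible with an explicit inverse, and the change of basis matrix from B to
-- B′ is B′ B⁻¹; multiplying out the entries gives the four stated sums.
{-# OPTIONS --safe #-}
module Submission where

open import Defs
open import Data.Nat using (ℕ; _∸_; _⊔_; _⊓_; _≤_)
import Data.Nat
open import Data.Integer using (+_)
open import Data.Rational using (_*_)
open import Data.Fin using (toℕ)
open import Data.Product using (_×_)

open import Algebra.Bundles using (Ring)
import Algebra.Properties.Semiring.Sum as Sum
open import Data.Fin.Base using (Fin; zero; suc; opposite)
open import Data.Fin.Properties using (toℕ<n; toℕ-injective; opposite-prop; opposite-involutive)
import Data.Integer.Base as ℤ
import Data.Integer.Properties as ℤ
open import Data.Nat.Base using (zero; suc; _<_; z≤n; s≤s)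
open import Data.Nat.Combinatorics using (_C_; k>n⇒nCk≡0; nCk+nC[k+1]≡[n+1]C[k+1]; nCk≡nC[n∸k])
import Data.Nat.Coprimality as Coprime
import Data.Nat.Properties as ℕ
open import Data.Product using (_,_)
open import Data.Rational using (ℚ; mkℚ; 0ℚ; 1ℚ; _+_; -_; _-_; _/_)
import Data.Rational.Properties as ℚ
open import Data.Sum using (_⊎_; inj₁; inj₂)
import Data.Sum as ⊎
open import Function using (_∘_; const)
open import Relation.Binary.PropositionalEquality
  using (_≡_; _≢_; refl; sym; trans; cong; cong₂; subst; module ≡-Reasoning)
open import Relation.Nullary.Decidable using (yes; no; dec⇒maybe)
open import Relation.Nullary.Negation using (contradiction)
open import Tactic.RingSolver using (solve-∀)
open import Tactic.RingSolver.Core.AlmostCommutativeRing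
  using (AlmostCommutativeRing; fromCommutativeRing)

open ≡-Reasoning
open Sum (Ring.semiring ℚ.+-*-ring)
  using (sum; sum-syntax; sum-cong-≗; sum-replicate-zero; ∑-distrib-+; ∑-comm; *-distribˡ-sum; *-distribʳ-sum)

private
  variable
    n : ℕ

ℚ-ring : AlmostCommutativeRing _ _
ℚ-ring = fromCommutativeRing ℚ.+-*-commutativeRing (λ x → dec⇒maybe (0ℚ ℚ.≟ x))

sign : ℕ → ℚ
sign k = sgn (+ k)

choose : ℕ → ℕ → ℚ
choose a b = binom a (+ b)

sign-+ : ∀ a b → sign (a Data.Nat.+ b) ≡ sign a * sign b
sign-+ zero    b = sym (ℚ.*-identityˡ (sign b))
sign-+ (suc a) b = trans (cong -_ (sign-+ a b)) (ℚ.neg-distribˡ-* (sign a) (sign b))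

sign-squared : ∀ a → sign a * sign a ≡ 1ℚ
sign-squared zero    = refl
sign-squared (suc a) = trans (neg-squared (sign a)) (sign-squared a)
  where
  neg-squared : ∀ x → (- x) * (- x) ≡ x * x
  neg-squared = solve-∀ ℚ-ring

sign-∸ : ∀ {a b} → b ≤ a → sign (a ∸ b) ≡ sign a * sign b
sign-∸ {a} z≤n     = sym (ℚ.*-identityʳ (sign a))
sign-∸ (s≤s {b} {a} b≤a) = trans (sign-∸ b≤a) (neg-neg (sign a) (sign b))
  where
  neg-neg : ∀ x y → x * y ≡ (- x) * (- y)
  neg-neg = solve-∀ ℚ-ring

sign-∸-∸ : ∀ {m a b} → a ≤ m → b ≤ m → sign (m ∸ a) * sign (m ∸ b) ≡ sign a * sign b
sign-∸-∸ {m} {a} {b} a≤m b≤m = begin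
  sign (m ∸ a) * sign (m ∸ b)                   ≡⟨ cong₂ _*_ (sign-∸ a≤m) (sign-∸ b≤m) ⟩
  sign m * sign a * (sign m * sign b)           ≡⟨ regroup (sign m) (sign a) (sign b) ⟩
  sign m * sign m * (sign a * sign b)           ≡⟨ cong (_* (sign a * sign b)) (sign-squared m) ⟩
  1ℚ * (sign a * sign b)                        ≡⟨ ℚ.*-identityˡ (sign a * sign b) ⟩
  sign a * sign b                               ∎
  where
  regroup : ∀ x y z → x * y * (x * z) ≡ x * x * (y * z)
  regroup = solve-∀ ℚ-ring

ℕ→ℚ-homo-+ : ∀ a b → ℕ→ℚ (a Data.Nat.+ b) ≡ ℕ→ℚ a + ℕ→ℚ b
ℕ→ℚ-homo-+ a b = begin
  + (a Data.Nat.+ b) / 1                  ≡⟨ cong (_/ 1) +[a+b]≡a*1+b*1 ⟩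
  (+ a ℤ.* + 1 ℤ.+ + b ℤ.* + 1) / 1       ≡⟨ cong₂ _+_ (ℕ→ℚ≡mkℚ a) (ℕ→ℚ≡mkℚ b) ⟨
  ℕ→ℚ a + ℕ→ℚ b                           ∎
  where
  ℕ→ℚ≡mkℚ : ∀ k → ℕ→ℚ k ≡ mkℚ (+ k) 0 (Coprime.sym (Coprime.1-coprimeTo k))
  ℕ→ℚ≡mkℚ k = ℚ.normalize-coprime (Coprime.sym (Coprime.1-coprimeTo k))
  +[a+b]≡a*1+b*1 : + (a Data.Nat.+ b) ≡ + a ℤ.* + 1 ℤ.+ + b ℤ.* + 1
  +[a+b]≡a*1+b*1 = trans (ℤ.pos-+ a b)
    (sym (cong₂ ℤ._+_ (ℤ.*-identityʳ (+ a)) (ℤ.*-identityʳ (+ b))))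

choose-pascal : ∀ a b → choose (suc a) (suc b) ≡ choose a b + choose a (suc b)
choose-pascal a b =
  trans (cong ℕ→ℚ (sym (nCk+nC[k+1]≡[n+1]C[k+1] a b))) (ℕ→ℚ-homo-+ (a C b) (a C suc b))

choose-vanish : ∀ {a b} → a < b → choose a b ≡ 0ℚ
choose-vanish a<b = cong ℕ→ℚ (k>n⇒nCk≡0 a<b)

choose-complement : ∀ {a b} → b ≤ a → choose a (a ∸ b) ≡ choose a b
choose-complement b≤a = cong ℕ→ℚ (sym (nCk≡nC[n∸k] b≤a))

x≡0⊎y≡0⇒x*y≡0 : ∀ {x y} → x ≡ 0ℚ ⊎ y ≡ 0ℚ → x * y ≡ 0ℚ
x≡0⊎y≡0⇒x*y≡0 {y = y} (inj₁ x≡0) = trans (cong (_* y) x≡0) (ℚ.*-zeroˡ y)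
x≡0⊎y≡0⇒x*y≡0 {x = x} (inj₂ y≡0) = trans (cong (x *_) y≡0) (ℚ.*-zeroʳ x)

δ : ℕ → ℕ → ℚ
δ zero    zero    = 1ℚ
δ zero    (suc _) = 0ℚ
δ (suc _) zero    = 0ℚ
δ (suc a) (suc b) = δ a b

δ-≡ : ∀ {a b} → a ≡ b → δ a b ≡ 1ℚ
δ-≡ {zero}  refl = refl
δ-≡ {suc a} refl = δ-≡ {a} refl

δ-≢ : ∀ {a b} → a ≢ b → δ a b ≡ 0ℚ
δ-≢ {zero}  {zero}  a≢b = contradiction refl a≢b
δ-≢ {zero}  {suc b} a≢b = refl
δ-≢ {suc a} {zero}  a≢b = refl
δ-≢ {suc a} {suc b} a≢b = δ-≢ (a≢b ∘ cong suc)

δ-cong : ∀ {a b a′ b′} → (a ≡ b → a′ ≡ b′) → (a′ ≡ b′ → a ≡ b) → δ a b ≡ δ a′ b′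
δ-cong {a} {b} to from with a ℕ.≟ b
... | yes a≡b = trans (δ-≡ a≡b) (sym (δ-≡ (to a≡b)))
... | no  a≢b = trans (δ-≢ a≢b) (sym (δ-≢ (a≢b ∘ from)))

ΣFin≡sum : (f : Fin n → ℚ) → ΣFin f ≡ sum f
ΣFin≡sum {zero}  f = refl
ΣFin≡sum {suc n} f = cong (_+_ (f zero)) (ΣFin≡sum (f ∘ suc))

∑-vanish : (f : Fin n → ℚ) → (∀ k → f k ≡ 0ℚ) → sum f ≡ 0ℚ
∑-vanish {n} f f≡0 = trans (sum-cong-≗ f≡0) (sum-replicate-zero n)

∑-scale : ∀ c {f g : Fin n → ℚ} → (∀ k → c * f k ≡ g k) → c * sum f ≡ sum g
∑-scale c {f} cf≡g = trans (*-distribˡ-sum c f) (sum-cong-≗ cf≡g)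

∑-δʳ : (f : Fin n → ℚ) (l : Fin n) → ∑[ k < n ] (f k * δ (toℕ k) (toℕ l)) ≡ f l
∑-δʳ f zero = begin
  f zero * 1ℚ + ∑[ k < _ ] (f (suc k) * 0ℚ) ≡⟨ cong₂ _+_ (ℚ.*-identityʳ (f zero)) (∑-vanish _ (ℚ.*-zeroʳ ∘ f ∘ suc)) ⟩
  f zero + 0ℚ                                ≡⟨ ℚ.+-identityʳ (f zero) ⟩
  f zero                                     ∎
∑-δʳ f (suc l) = begin
  f zero * 0ℚ + ∑[ k < _ ] (f (suc k) * δ (toℕ k) (toℕ l)) ≡⟨ cong₂ _+_ (ℚ.*-zeroʳ (f zero)) (∑-δʳ (f ∘ suc) l) ⟩
  0ℚ + f (suc l)                                            ≡⟨ ℚ.+-identityˡ (f (suc l)) ⟩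
  f (suc l)                                                 ∎

∑-δˡ : (f : Fin n → ℚ) (l : Fin n) → ∑[ k < n ] (δ (toℕ l) (toℕ k) * f k) ≡ f l
∑-δˡ f zero = begin
  1ℚ * f zero + ∑[ k < _ ] (0ℚ * f (suc k)) ≡⟨ cong₂ _+_ (ℚ.*-identityˡ (f zero)) (∑-vanish _ (ℚ.*-zeroˡ ∘ f ∘ suc)) ⟩
  f zero + 0ℚ                                ≡⟨ ℚ.+-identityʳ (f zero) ⟩
  f zero                                     ∎
∑-δˡ f (suc l) = begin
  0ℚ * f zero + ∑[ k < _ ] (δ (toℕ l) (toℕ k) * f (suc k)) ≡⟨ cong₂ _+_ (ℚ.*-zeroˡ (f zero)) (∑-δˡ (f ∘ suc) l) ⟩
  0ℚ + f (suc l)                                            ≡⟨ ℚ.+-identityˡ (f (suc l)) ⟩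
  f (suc l)                                                 ∎

-- Binomial inversion

inversionSum : ℕ → ℕ → ℕ → ℚ
inversionSum n s j = ∑[ t < n ] (sign (toℕ t) * choose s (toℕ t) * choose (toℕ t) j)

shiftedInversionSum : ℕ → ℕ → ℕ → ℚ
shiftedInversionSum n s j = ∑[ t < n ] (sign (toℕ t) * choose s (toℕ t) * choose (suc (toℕ t)) j)

inversionSum-pascal : ∀ n s j →
  inversionSum (suc n) (suc s) j + shiftedInversionSum n s j ≡ inversionSum (suc n) s j
inversionSum-pascal n s j = begin
  (x₀ + ∑[ t < n ] A t) + ∑[ t < n ] W t  ≡⟨ ℚ.+-assoc x₀ _ _ ⟩
  x₀ + (∑[ t < n ] A t + ∑[ t < n ] W t)  ≡⟨ cong (_+_ x₀) (sym (∑-distrib-+ A W)) ⟩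
  x₀ + ∑[ t < n ] (A t + W t)             ≡⟨ cong (_+_ x₀) (sum-cong-≗ pascal) ⟩
  x₀ + ∑[ t < n ] B t                     ∎
  where
  -- C(s+1,0) and C(s,0) both compute to 1, so x₀ is the first term of both sums.
  x₀ : ℚ
  x₀ = sign 0 * choose s 0 * choose 0 j
  A B W : Fin n → ℚ
  A t = sign (suc (toℕ t)) * choose (suc s) (suc (toℕ t)) * choose (suc (toℕ t)) j
  B t = sign (suc (toℕ t)) * choose s (suc (toℕ t)) * choose (suc (toℕ t)) j
  W t = sign (toℕ t) * choose s (toℕ t) * choose (suc (toℕ t)) j
  cancel : ∀ x a b y → (- x) * (a + b) * y + x * a * y ≡ (- x) * b * y
  cancel = solve-∀ ℚ-ring
  pascal : ∀ t → A t + W t ≡ B t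
  pascal t = trans (cong (λ c → (- sign (toℕ t)) * c * choose (suc (toℕ t)) j + W t) (choose-pascal s (toℕ t)))
                   (cancel (sign (toℕ t)) (choose s (toℕ t)) (choose s (suc (toℕ t))) (choose (suc (toℕ t)) j))

shiftedInversionSum-pascal : ∀ n s j →
  shiftedInversionSum n s (suc j) ≡ inversionSum n s j + inversionSum n s (suc j)
shiftedInversionSum-pascal n s j =
  trans (sum-cong-≗ split) (∑-distrib-+ (λ t → T t j) (λ t → T t (suc j)))
  where
  T : Fin n → ℕ → ℚ
  T t k = sign (toℕ t) * choose s (toℕ t) * choose (toℕ t) k
  split : ∀ t → sign (toℕ t) * choose s (toℕ t) * choose (suc (toℕ t)) (suc j) ≡ T t j + T t (suc j)
  split t = trans (cong (sign (toℕ t) * choose s (toℕ t) *_) (choose-pascal (toℕ t) j))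
                  (ℚ.*-distribˡ-+ (sign (toℕ t) * choose s (toℕ t)) _ _)

x+w≡y⇒x≡y-w : ∀ {x w y} → x + w ≡ y → x ≡ y - w
x+w≡y⇒x≡y-w {x} {w} refl = add-sub x w
  where
  add-sub : ∀ x w → x ≡ (x + w) - w
  add-sub = solve-∀ ℚ-ring

binomial-inversion : ∀ {n} s j → s < n → inversionSum n s j ≡ sign j * δ s j
binomial-inversion {suc n} zero j _ = begin
  sign 0 * choose 0 0 * choose 0 j + ∑[ t < n ] (sign (suc (toℕ t)) * 0ℚ * choose (suc (toℕ t)) j)
    ≡⟨ cong (_+_ (sign 0 * choose 0 0 * choose 0 j)) (∑-vanish {n} (λ t → sign (suc (toℕ t)) * 0ℚ * choose (suc (toℕ t)) j)
                                                                 (λ t → x≡0⊎y≡0⇒x*y≡0 (inj₁ (ℚ.*-zeroʳ (sign (suc (toℕ t))))))) ⟩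
  sign 0 * choose 0 0 * choose 0 j + 0ℚ
    ≡⟨ ℚ.+-identityʳ _ ⟩
  sign 0 * choose 0 0 * choose 0 j
    ≡⟨ row₀ j ⟩
  sign j * δ 0 j ∎
  where
  row₀ : ∀ j → sign 0 * choose 0 0 * choose 0 j ≡ sign j * δ 0 j
  row₀ zero    = refl
  row₀ (suc j) = sym (ℚ.*-zeroʳ (sign (suc j)))
-- For j = 0 the shifted sum is the unshifted one, since C(t+1,0) and C(t,0) both compute to 1.
binomial-inversion {suc n} (suc s) zero (s≤s s<n) = begin
  inversionSum (suc n) (suc s) 0                  ≡⟨ x+w≡y⇒x≡y-w (inversionSum-pascal n s 0) ⟩
  inversionSum (suc n) s 0 - inversionSum n s 0   ≡⟨ cong₂ _-_ (binomial-inversion s 0 (ℕ.m≤n⇒m≤1+n s<n)) (binomial-inversion s 0 s<n) ⟩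
  sign 0 * δ s 0 - sign 0 * δ s 0                 ≡⟨ ℚ.+-inverseʳ (sign 0 * δ s 0) ⟩
  0ℚ                                              ∎
binomial-inversion {suc n} (suc s) (suc j) (s≤s s<n) = begin
  inversionSum (suc n) (suc s) (suc j)
    ≡⟨ x+w≡y⇒x≡y-w (inversionSum-pascal n s (suc j)) ⟩
  inversionSum (suc n) s (suc j) - shiftedInversionSum n s (suc j)
    ≡⟨ cong (_-_ (inversionSum (suc n) s (suc j))) (shiftedInversionSum-pascal n s j) ⟩
  inversionSum (suc n) s (suc j) - (inversionSum n s j + inversionSum n s (suc j))
    ≡⟨ cong₂ _-_ (binomial-inversion s (suc j) (ℕ.m≤n⇒m≤1+n s<n))
                 (cong₂ _+_ (binomial-inversion s j s<n) (binomial-inversion s (suc j) s<n)) ⟩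
  sign (suc j) * δ s (suc j) - (sign j * δ s j + sign (suc j) * δ s (suc j))
    ≡⟨ cancel (sign (suc j) * δ s (suc j)) (sign j * δ s j) ⟩
  - (sign j * δ s j)
    ≡⟨ ℚ.neg-distribˡ-* (sign j) (δ s j) ⟩
  sign (suc j) * δ (suc s) (suc j) ∎
  where
  cancel : ∀ a b → a - (b + a) ≡ - b
  cancel = solve-∀ ℚ-ring

Matrix : ℕ → Set
Matrix n = Fin n → Fin n → ℚ

infix 4 _≈_
_≈_ : Matrix n → Matrix n → Set
A ≈ B = ∀ i j → A i j ≡ B i j

≈-refl : {A : Matrix n} → A ≈ A
≈-refl _ _ = refl

≈-sym : {A B : Matrix n} → A ≈ B → B ≈ A
≈-sym A≈B i j = sym (A≈B i j)

infixl 7 _·_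
_·_ : Matrix n → Matrix n → Matrix n
(A · B) i j = sum (λ k → A i k * B k j)

1M : Matrix n
1M i j = δ (toℕ i) (toℕ j)

·-congˡ : (A : Matrix n) {B B′ : Matrix n} → B ≈ B′ → A · B ≈ A · B′
·-congˡ A B≈B′ i j = sum-cong-≗ (λ k → cong (A i k *_) (B≈B′ k j))

·-congʳ : (B : Matrix n) {A A′ : Matrix n} → A ≈ A′ → A · B ≈ A′ · B
·-congʳ B A≈A′ i j = sum-cong-≗ (λ k → cong (_* B k j) (A≈A′ i k))

·-assoc : (A B C : Matrix n) → (A · B) · C ≈ A · (B · C)
·-assoc A B C i j = begin
  sum (λ k → sum (λ l → A i l * B l k) * C k j)   ≡⟨ sum-cong-≗ (λ k → *-distribʳ-sum (C k j) (λ l → A i l * B l k)) ⟩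
  sum (λ k → sum (λ l → A i l * B l k * C k j))   ≡⟨ ∑-comm (λ k l → A i l * B l k * C k j) ⟩
  sum (λ l → sum (λ k → A i l * B l k * C k j))   ≡⟨ sum-cong-≗ (λ l → ∑-scale (A i l) (λ k → sym (ℚ.*-assoc (A i l) (B l k) (C k j)))) ⟨
  sum (λ l → A i l * sum (λ k → B l k * C k j))   ∎

·-identityˡ : (A : Matrix n) → 1M · A ≈ A
·-identityˡ A i j = ∑-δˡ (λ k → A k j) i

·-identityʳ : (A : Matrix n) → A · 1M ≈ A
·-identityʳ A i j = ∑-δʳ (A i) j

record IsInverse (A X : Matrix n) : Set where
  constructor _,_
  field
    rightInverse : A · X ≈ 1M
    leftInverse  : X · A ≈ 1M

inverse-cong : {A A′ X X′ : Matrix n} → A ≈ A′ → X ≈ X′ → IsInverse A X → IsInverse A′ X′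
inverse-cong {A = A} {A′} {X} {X′} A≈A′ X≈X′ (AX≈1 , XA≈1) =
  transport A X A′ X′ A≈A′ X≈X′ AX≈1 , transport X A X′ A′ X≈X′ A≈A′ XA≈1
  where
  transport : ∀ A X A′ X′ → A ≈ A′ → X ≈ X′ → A · X ≈ 1M → A′ · X′ ≈ 1M
  transport A X A′ X′ A≈A′ X≈X′ AX≈1 i j = begin
    (A′ · X′) i j   ≡⟨ ·-congʳ X′ A≈A′ i j ⟨
    (A · X′) i j    ≡⟨ ·-congˡ A X≈X′ i j ⟨
    (A · X) i j     ≡⟨ AX≈1 i j ⟩
    1M i j          ∎

·-rightInverse : ∀ A B X Y → A · X ≈ 1M → B · Y ≈ (1M {n}) → (A · B) · (Y · X) ≈ 1M
·-rightInverse A B X Y AX≈1 BY≈1 i j = begin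
  ((A · B) · (Y · X)) i j   ≡⟨ ·-assoc A B (Y · X) i j ⟩
  (A · (B · (Y · X))) i j   ≡⟨ ·-congˡ A (·-assoc B Y X) i j ⟨
  (A · ((B · Y) · X)) i j   ≡⟨ ·-congˡ A (·-congʳ X BY≈1) i j ⟩
  (A · (1M · X)) i j        ≡⟨ ·-congˡ A (·-identityˡ X) i j ⟩
  (A · X) i j               ≡⟨ AX≈1 i j ⟩
  1M i j                    ∎

inverse-sym : {A X : Matrix n} → IsInverse A X → IsInverse X A
inverse-sym (AX≈1 , XA≈1) = XA≈1 , AX≈1

inverse-· : {A B X Y : Matrix n} → IsInverse A X → IsInverse B Y → IsInverse (A · B) (Y · X)
inverse-· {A = A} {B} {X} {Y} (AX≈1 , XA≈1) (BY≈1 , YB≈1) =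
  ·-rightInverse A B X Y AX≈1 BY≈1 , ·-rightInverse Y X B A YB≈1 XA≈1

-- With κ and v read as matrices with constant rows: κ = κ (B X) = (κ B) X = v X.
coords-determined : (B X : Matrix (suc n)) → B · X ≈ 1M →
  ∀ {v} κ → IsCoords B v κ → ∀ l → κ l ≡ sum (λ j → v j * X j l)
coords-determined B X BX≈1 {v} κ κB≡v l = begin
  κ l                         ≡⟨ ·-identityʳ K zero l ⟨
  (K · 1M) zero l             ≡⟨ ·-congˡ K BX≈1 zero l ⟨
  (K · (B · X)) zero l        ≡⟨ ·-assoc K B X zero l ⟨
  ((K · B) · X) zero l        ≡⟨ ·-congʳ X KB≈V zero l ⟩
  sum (λ j → v j * X j l)     ∎
  where
  K V : Matrix (suc _)
  K = const κ
  V = const v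
  KB≈V : K · B ≈ V
  KB≈V _ j = trans (sym (ΣFin≡sum (λ k → κ k * B k j))) (κB≡v j)

changeOfBasis : {B B′ X M : Matrix (suc n)} → IsInverse B X → M ≈ B′ · X → IsChangeOfBasis B B′ M
changeOfBasis {B = B} {B′} {X} {M} (BX≈1 , XB≈1) M≈B′X i = coords , unique
  where
  MB≈B′ : M · B ≈ B′
  MB≈B′ i j = begin
    (M · B) i j          ≡⟨ ·-congʳ B M≈B′X i j ⟩
    ((B′ · X) · B) i j   ≡⟨ ·-assoc B′ X B i j ⟩
    (B′ · (X · B)) i j   ≡⟨ ·-congˡ B′ XB≈1 i j ⟩
    (B′ · 1M) i j        ≡⟨ ·-identityʳ B′ i j ⟩
    B′ i j               ∎
  coords : IsCoords B (B′ i) (M i)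
  coords j = trans (ΣFin≡sum (λ k → M i k * B k j)) (MB≈B′ i j)
  unique : ∀ κ → IsCoords B (B′ i) κ → ∀ k → κ k ≡ M i k
  unique κ κB≡B′ᵢ k = trans (coords-determined B X BX≈1 κ κB≡B′ᵢ k) (sym (coords-determined B X BX≈1 (M i) coords k))

-- Exchange, sign and Pascal matrices

exchange : Matrix n
exchange i j = 1M i (opposite j)

signs : Matrix n
signs i j = sign (toℕ i) * 1M i j

pascal : Matrix n
pascal i j = choose (toℕ i) (toℕ j)

signedPascal : Matrix n
signedPascal i j = choose (toℕ i) (toℕ j) * sign (toℕ j)

1M-opposite : (i k : Fin n) → 1M i (opposite k) ≡ 1M (opposite i) k
1M-opposite i k = δ-cong
  (λ i≡k′ → cong toℕ (trans (cong opposite (toℕ-injective i≡k′)) (opposite-involutive k)))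
  (λ i′≡k → cong toℕ (trans (sym (opposite-involutive i)) (cong opposite (toℕ-injective i′≡k))))

·-exchange : (A : Matrix n) → ∀ i j → (A · exchange) i j ≡ A i (opposite j)
·-exchange A i j = ∑-δʳ (A i) (opposite j)

exchange-· : (A : Matrix n) → ∀ i j → (exchange · A) i j ≡ A (opposite i) j
exchange-· A i j = trans (sum-cong-≗ (λ k → cong (_* A k j) (1M-opposite i k))) (∑-δˡ (λ k → A k j) (opposite i))

signs-· : (A : Matrix n) → ∀ i j → (signs · A) i j ≡ sign (toℕ i) * A i j
signs-· A i j = begin
  sum (λ k → sign (toℕ i) * 1M i k * A k j)     ≡⟨ sum-cong-≗ (λ k → ℚ.*-assoc (sign (toℕ i)) (1M i k) (A k j)) ⟩
  sum (λ k → sign (toℕ i) * (1M i k * A k j))   ≡⟨ *-distribˡ-sum (sign (toℕ i)) (λ k → 1M i k * A k j) ⟨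
  sign (toℕ i) * sum (λ k → 1M i k * A k j)     ≡⟨ cong (sign (toℕ i) *_) (∑-δˡ (λ k → A k j) i) ⟩
  sign (toℕ i) * A i j                          ∎

·-signs : (A : Matrix n) → ∀ i j → (A · signs) i j ≡ A i j * sign (toℕ j)
·-signs A i j = trans (sum-cong-≗ (λ k → sym (ℚ.*-assoc (A i k) (sign (toℕ k)) (1M k j))))
                      (∑-δʳ (λ k → A i k * sign (toℕ k)) j)

selfInverse : {A : Matrix n} → A · A ≈ 1M → IsInverse A A
selfInverse AA≈1 = AA≈1 , AA≈1

exchange-inverse : IsInverse (exchange {n}) exchange
exchange-inverse = selfInverse λ i j → trans (·-exchange exchange i j) (cong (1M i) (opposite-involutive j))

signs-inverse : IsInverse (signs {n}) signs
signs-inverse = selfInverse λ i j → begin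
  (signs · signs) i j                          ≡⟨ signs-· signs i j ⟩
  sign (toℕ i) * (sign (toℕ i) * 1M i j)       ≡⟨ ℚ.*-assoc (sign (toℕ i)) (sign (toℕ i)) (1M i j) ⟨
  sign (toℕ i) * sign (toℕ i) * 1M i j         ≡⟨ cong (_* 1M i j) (sign-squared (toℕ i)) ⟩
  1ℚ * 1M i j                                  ≡⟨ ℚ.*-identityˡ (1M i j) ⟩
  1M i j                                       ∎

signedPascal-inverse : IsInverse (signedPascal {n}) signedPascal
signedPascal-inverse {n} = selfInverse λ i j → begin
  ∑[ k < n ] (choose (toℕ i) (toℕ k) * sign (toℕ k) * (choose (toℕ k) (toℕ j) * sign (toℕ j)))
    ≡⟨ sum-cong-≗ {n} (λ k → regroup (choose (toℕ i) (toℕ k)) (sign (toℕ k)) (choose (toℕ k) (toℕ j)) (sign (toℕ j))) ⟩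
  ∑[ k < n ] (sign (toℕ k) * choose (toℕ i) (toℕ k) * choose (toℕ k) (toℕ j) * sign (toℕ j))
    ≡⟨ *-distribʳ-sum {n} (sign (toℕ j)) (λ k → sign (toℕ k) * choose (toℕ i) (toℕ k) * choose (toℕ k) (toℕ j)) ⟨
  inversionSum n (toℕ i) (toℕ j) * sign (toℕ j)
    ≡⟨ cong (_* sign (toℕ j)) (binomial-inversion (toℕ i) (toℕ j) (toℕ<n i)) ⟩
  sign (toℕ j) * 1M i j * sign (toℕ j)
    ≡⟨ regroup′ (sign (toℕ j)) (1M i j) ⟩
  sign (toℕ j) * sign (toℕ j) * 1M i j
    ≡⟨ cong (_* 1M i j) (sign-squared (toℕ j)) ⟩
  1ℚ * 1M i j
    ≡⟨ ℚ.*-identityˡ (1M i j) ⟩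
  1M i j ∎
  where
  regroup : ∀ a s b t → a * s * (b * t) ≡ s * a * b * t
  regroup = solve-∀ ℚ-ring
  regroup′ : ∀ s d → s * d * s ≡ s * s * d
  regroup′ = solve-∀ ℚ-ring

pascal≈signedPascal·signs : pascal {n} ≈ signedPascal · signs
pascal≈signedPascal·signs i j = sym (begin
  (signedPascal · signs) i j                                        ≡⟨ ·-signs signedPascal i j ⟩
  choose (toℕ i) (toℕ j) * sign (toℕ j) * sign (toℕ j)              ≡⟨ ℚ.*-assoc (choose (toℕ i) (toℕ j)) _ _ ⟩
  choose (toℕ i) (toℕ j) * (sign (toℕ j) * sign (toℕ j))            ≡⟨ cong (choose (toℕ i) (toℕ j) *_) (sign-squared (toℕ j)) ⟩
  choose (toℕ i) (toℕ j) * 1ℚ                                       ≡⟨ ℚ.*-identityʳ (choose (toℕ i) (toℕ j)) ⟩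
  choose (toℕ i) (toℕ j)                                            ∎)

pascal-inverse : IsInverse (pascal {n}) (signs · signedPascal)
pascal-inverse = inverse-cong (≈-sym pascal≈signedPascal·signs) ≈-refl (inverse-· signedPascal-inverse signs-inverse)

sumFrom-suc : ∀ a k (f : ℕ → ℚ) → sumFrom (suc a) k f ≡ sumFrom a k (f ∘ suc)
sumFrom-suc a zero    f = refl
sumFrom-suc a (suc k) f = cong (_+_ (f (suc a))) (sumFrom-suc (suc a) k f)

sumFrom-sum : ∀ k (f : ℕ → ℚ) → sumFrom 0 k f ≡ ∑[ s < k ] f (toℕ s)
sumFrom-sum zero    f = refl
sumFrom-sum (suc k) f = cong (_+_ (f 0)) (trans (sumFrom-suc 0 k f) (sumFrom-sum k (f ∘ suc)))

sumFrom-split : ∀ a k l (f : ℕ → ℚ) → sumFrom a (k Data.Nat.+ l) f ≡ sumFrom a k f + sumFrom (a Data.Nat.+ k) l f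
sumFrom-split a zero l f = begin
  sumFrom a l f                       ≡⟨ cong (λ b → sumFrom b l f) (ℕ.+-identityʳ a) ⟨
  sumFrom (a Data.Nat.+ 0) l f        ≡⟨ ℚ.+-identityˡ _ ⟨
  0ℚ + sumFrom (a Data.Nat.+ 0) l f   ∎
sumFrom-split a (suc k) l f = begin
  f a + sumFrom (suc a) (k Data.Nat.+ l) f                            ≡⟨ cong (_+_ (f a)) (sumFrom-split (suc a) k l f) ⟩
  f a + (sumFrom (suc a) k f + sumFrom (suc a Data.Nat.+ k) l f)      ≡⟨ ℚ.+-assoc (f a) _ _ ⟨
  f a + sumFrom (suc a) k f + sumFrom (suc a Data.Nat.+ k) l f        ≡⟨ cong (λ b → f a + sumFrom (suc a) k f + sumFrom b l f) (ℕ.+-suc a k) ⟨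
  f a + sumFrom (suc a) k f + sumFrom (a Data.Nat.+ suc k) l f        ∎

sumFrom-vanish : ∀ a k (f : ℕ → ℚ) → (∀ s → a ≤ s → s < a Data.Nat.+ k → f s ≡ 0ℚ) → sumFrom a k f ≡ 0ℚ
sumFrom-vanish a zero    f _ = refl
sumFrom-vanish a (suc k) f f≡0 = begin
  f a + sumFrom (suc a) k f   ≡⟨ cong₂ _+_ (f≡0 a ℕ.≤-refl (ℕ.m<m+n a (s≤s z≤n))) (sumFrom-vanish (suc a) k f f′≡0) ⟩
  0ℚ + 0ℚ                     ≡⟨ ℚ.+-identityˡ 0ℚ ⟩
  0ℚ                          ∎
  where
  f′≡0 : ∀ s → suc a ≤ s → s < suc a Data.Nat.+ k → f s ≡ 0ℚ
  f′≡0 s a<s s<a+1+k = f≡0 s (ℕ.<⇒≤ a<s) (subst (s <_) (sym (ℕ.+-suc a k)) s<a+1+k)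

sumRange-from : ∀ m lo (f : ℕ → ℚ) → lo ≤ m → (∀ s → s < lo → f s ≡ 0ℚ) →
  sumRange lo m f ≡ ∑[ s < suc m ] f (toℕ s)
sumRange-from m lo f lo≤m f≡0 = begin
  sumFrom lo (suc m ∸ lo) f                     ≡⟨ ℚ.+-identityˡ _ ⟨
  0ℚ + sumFrom lo (suc m ∸ lo) f                ≡⟨ cong (_+ sumFrom lo (suc m ∸ lo) f) (sumFrom-vanish 0 lo f (λ s _ → f≡0 s)) ⟨
  sumFrom 0 lo f + sumFrom lo (suc m ∸ lo) f    ≡⟨ sumFrom-split 0 lo (suc m ∸ lo) f ⟨
  sumFrom 0 (lo Data.Nat.+ (suc m ∸ lo)) f      ≡⟨ cong (λ k → sumFrom 0 k f) (ℕ.m+[n∸m]≡n (ℕ.m≤n⇒m≤1+n lo≤m)) ⟩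
  sumFrom 0 (suc m) f                           ≡⟨ sumFrom-sum (suc m) f ⟩
  ∑[ s < suc m ] f (toℕ s)                      ∎

sumRange-upTo : ∀ m hi (f : ℕ → ℚ) → hi ≤ m → (∀ s → hi < s → s ≤ m → f s ≡ 0ℚ) →
  sumRange 0 hi f ≡ ∑[ s < suc m ] f (toℕ s)
sumRange-upTo m hi f hi≤m f≡0 = begin
  sumFrom 0 (suc hi) f                                   ≡⟨ ℚ.+-identityʳ _ ⟨
  sumFrom 0 (suc hi) f + 0ℚ                              ≡⟨ cong (_+_ (sumFrom 0 (suc hi) f)) (sumFrom-vanish (suc hi) (m ∸ hi) f f′≡0) ⟨
  sumFrom 0 (suc hi) f + sumFrom (suc hi) (m ∸ hi) f     ≡⟨ sumFrom-split 0 (suc hi) (m ∸ hi) f ⟨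
  sumFrom 0 (suc hi Data.Nat.+ (m ∸ hi)) f               ≡⟨ cong (λ k → sumFrom 0 k f) hi+[m∸hi]≡m ⟩
  sumFrom 0 (suc m) f                                    ≡⟨ sumFrom-sum (suc m) f ⟩
  ∑[ s < suc m ] f (toℕ s)                               ∎
  where
  hi+[m∸hi]≡m : suc hi Data.Nat.+ (m ∸ hi) ≡ suc m
  hi+[m∸hi]≡m = cong suc (ℕ.m+[n∸m]≡n hi≤m)
  f′≡0 : ∀ s → suc hi ≤ s → s < suc hi Data.Nat.+ (m ∸ hi) → f s ≡ 0ℚ
  f′≡0 s hi<s s<… = f≡0 s hi<s (ℕ.≤-pred (subst (s <_) hi+[m∸hi]≡m s<…))

<-⊔⁻ : ∀ {s a b} → s < a ⊔ b → s < a ⊎ s < b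
<-⊔⁻ {s} {a} {b} s<a⊔b = ⊎.map (λ e → subst (s <_) e s<a⊔b) (λ e → subst (s <_) e s<a⊔b) (ℕ.⊔-sel a b)

⊓-<⁻ : ∀ {s a b} → a ⊓ b < s → a < s ⊎ b < s
⊓-<⁻ {s} {a} {b} a⊓b<s = ⊎.map (λ e → subst (_< s) e a⊓b<s) (λ e → subst (_< s) e a⊓b<s) (ℕ.⊓-sel a b)

o<m∸n⇒n<m∸o : ∀ {m n o} → n ≤ m → o < m ∸ n → n < m ∸ o
o<m∸n⇒n<m∸o {m} {n} {o} n≤m o<m∸n = subst (_< m ∸ o) (ℕ.m∸[m∸n]≡n n≤m) (ℕ.∸-monoʳ-< o<m∸n (ℕ.m∸n≤m m n))

m∸n<o⇒m∸o<n : ∀ {m n o} → n ≤ m → o ≤ m → m ∸ n < o → m ∸ o < n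
m∸n<o⇒m∸o<n {m} {n} {o} n≤m o≤m m∸n<o = subst (m ∸ o <_) (ℕ.m∸[m∸n]≡n n≤m) (ℕ.∸-monoʳ-< m∸n<o o≤m)

-- The four bases

module _ (m : ℕ) where

  private
    toℕ≤m : (i : Fin (suc m)) → toℕ i ≤ m
    toℕ≤m i = ℕ.≤-pred (toℕ<n i)

  Fdown-entry : ∀ i j → Fdown m i j ≡ choose (toℕ i) (m ∸ toℕ j)
  Fdown-entry i j = cong (binom (toℕ i)) (trans (ℤ.m-n≡m⊖n m (toℕ j)) (ℤ.⊖-≥ (toℕ≤m j)))

  Hbullet-entry : ∀ i j → Hbullet m i j ≡ sign (toℕ i) * sign (toℕ j) * choose (m ∸ toℕ i) (m ∸ toℕ j)
  Hbullet-entry i j = entry (toℕ i) (toℕ j) (toℕ≤m i) (toℕ≤m j)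
    where
    entry : ∀ a b → a ≤ m → b ≤ m →
      sgn (+ b ℤ.- + a) * binom (m ∸ a) (+ b ℤ.- + a) ≡ sign a * sign b * choose (m ∸ a) (m ∸ b)
    entry a b a≤m b≤m with a ℕ.≤? b
    ... | yes a≤b = begin
      sgn (+ b ℤ.- + a) * binom (m ∸ a) (+ b ℤ.- + a)   ≡⟨ cong (λ z → sgn z * binom (m ∸ a) z) b-a≡b∸a ⟩
      sign (b ∸ a) * choose (m ∸ a) (b ∸ a)             ≡⟨ cong₂ _*_ (sign-∸ a≤b) (sym (choose-complement b∸a≤m∸a)) ⟩
      sign b * sign a * choose (m ∸ a) ((m ∸ a) ∸ (b ∸ a)) ≡⟨ cong₂ (λ x c → x * choose (m ∸ a) c) (ℚ.*-comm (sign b) (sign a)) [m∸a]∸[b∸a]≡m∸b ⟩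
      sign a * sign b * choose (m ∸ a) (m ∸ b)          ∎
      where
      b-a≡b∸a : + b ℤ.- + a ≡ + (b ∸ a)
      b-a≡b∸a = trans (ℤ.m-n≡m⊖n b a) (ℤ.⊖-≥ a≤b)
      b∸a≤m∸a : b ∸ a ≤ m ∸ a
      b∸a≤m∸a = ℕ.∸-monoˡ-≤ a b≤m
      [m∸a]∸[b∸a]≡m∸b : (m ∸ a) ∸ (b ∸ a) ≡ m ∸ b
      [m∸a]∸[b∸a]≡m∸b = trans (ℕ.∸-+-assoc m a (b ∸ a)) (cong (m ∸_) (ℕ.m+[n∸m]≡n a≤b))
    ... | no a≰b = begin
      sgn (+ b ℤ.- + a) * binom (m ∸ a) (+ b ℤ.- + a)   ≡⟨ cong (λ z → sgn z * binom (m ∸ a) z) b-a≡-[1+a∸b-1] ⟩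
      sgn ℤ.-[1+ a ∸ suc b ] * 0ℚ                       ≡⟨ ℚ.*-zeroʳ (sgn ℤ.-[1+ a ∸ suc b ]) ⟩
      0ℚ                                                ≡⟨ ℚ.*-zeroʳ (sign a * sign b) ⟨
      sign a * sign b * 0ℚ                              ≡⟨ cong (sign a * sign b *_) (choose-vanish (ℕ.∸-monoʳ-< b<a a≤m)) ⟨
      sign a * sign b * choose (m ∸ a) (m ∸ b)          ∎
      where
      b<a : b < a
      b<a = ℕ.≰⇒> a≰b
      b-a≡-[1+a∸b-1] : + b ℤ.- + a ≡ ℤ.-[1+ a ∸ suc b ]
      b-a≡-[1+a∸b-1] = trans (ℤ.m-n≡m⊖n b a) (trans (ℤ.⊖-< b<a) (cong (λ k → ℤ.- (+ k)) (ℕ.+-∸-assoc 1 b<a)))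

  Fdown≈pascal·exchange : Fdown m ≈ pascal · exchange
  Fdown≈pascal·exchange i j = begin
    Fdown m i j                   ≡⟨ Fdown-entry i j ⟩
    choose (toℕ i) (m ∸ toℕ j)    ≡⟨ cong (choose (toℕ i)) (opposite-prop j) ⟨
    pascal i (opposite j)         ≡⟨ ·-exchange pascal i j ⟨
    (pascal · exchange) i j       ∎

  Hup≈exchange·signedPascal : Hup m ≈ exchange · signedPascal
  Hup≈exchange·signedPascal i j = begin
    sign (toℕ j) * choose (m ∸ toℕ i) (toℕ j)   ≡⟨ ℚ.*-comm (sign (toℕ j)) _ ⟩
    choose (m ∸ toℕ i) (toℕ j) * sign (toℕ j)   ≡⟨ cong (λ a → choose a (toℕ j) * sign (toℕ j)) (opposite-prop i) ⟨
    signedPascal (opposite i) j                 ≡⟨ exchange-· signedPascal i j ⟨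
    (exchange · signedPascal) i j               ∎

  Hbullet≈exchange·pascal⁻¹·exchange : Hbullet m ≈ exchange · ((signs · signedPascal) · exchange)
  Hbullet≈exchange·pascal⁻¹·exchange i j = sym (begin
    (exchange · ((signs · signedPascal) · exchange)) i j
      ≡⟨ exchange-· ((signs · signedPascal) · exchange) i j ⟩
    ((signs · signedPascal) · exchange) (opposite i) j
      ≡⟨ ·-exchange (signs · signedPascal) (opposite i) j ⟩
    (signs · signedPascal) (opposite i) (opposite j)
      ≡⟨ signs-· signedPascal (opposite i) (opposite j) ⟩
    sign (toℕ (opposite i)) * (choose (toℕ (opposite i)) (toℕ (opposite j)) * sign (toℕ (opposite j)))
      ≡⟨ cong₂ (λ a b → sign a * (choose a b * sign b)) (opposite-prop i) (opposite-prop j) ⟩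
    sign (m ∸ toℕ i) * (choose (m ∸ toℕ i) (m ∸ toℕ j) * sign (m ∸ toℕ j))
      ≡⟨ regroup (sign (m ∸ toℕ i)) (choose (m ∸ toℕ i) (m ∸ toℕ j)) (sign (m ∸ toℕ j)) ⟩
    sign (m ∸ toℕ i) * sign (m ∸ toℕ j) * choose (m ∸ toℕ i) (m ∸ toℕ j)
      ≡⟨ cong (_* choose (m ∸ toℕ i) (m ∸ toℕ j)) (sign-∸-∸ (toℕ≤m i) (toℕ≤m j)) ⟩
    sign (toℕ i) * sign (toℕ j) * choose (m ∸ toℕ i) (m ∸ toℕ j)
      ≡⟨ Hbullet-entry i j ⟨
    Hbullet m i j ∎)
    where
    regroup : ∀ x c y → x * (c * y) ≡ x * y * c
    regroup = solve-∀ ℚ-ring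

  Fdown-inverse : IsInverse (Fdown m) (exchange · (signs · signedPascal))
  Fdown-inverse = inverse-cong (≈-sym Fdown≈pascal·exchange) ≈-refl (inverse-· pascal-inverse exchange-inverse)

  Hup-inverse : IsInverse (Hup m) (signedPascal · exchange)
  Hup-inverse = inverse-cong (≈-sym Hup≈exchange·signedPascal) ≈-refl (inverse-· exchange-inverse signedPascal-inverse)

  Hbullet-inverse : IsInverse (Hbullet m) ((exchange · pascal) · exchange)
  Hbullet-inverse = inverse-cong (≈-sym Hbullet≈exchange·pascal⁻¹·exchange) ≈-refl
    (inverse-· exchange-inverse (inverse-· (inverse-sym pascal-inverse) exchange-inverse))

  Hup→Fdown : (λ i j → sign (m ∸ toℕ j) * sumRange ((m ∸ toℕ i) ⊔ (m ∸ toℕ j)) m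
                 (λ s → choose (toℕ i) (m ∸ s) * choose s (m ∸ toℕ j)))
              ≈ Fdown m · (signedPascal · exchange)
  Hup→Fdown i j =
    trans (cong (sign (m ∸ toℕ j) *_) (sumRange-from m _ F (ℕ.⊔-lub (ℕ.m∸n≤m m (toℕ i)) (ℕ.m∸n≤m m (toℕ j))) F≡0))
          (∑-scale (sign (m ∸ toℕ j)) term)
    where
    F : ℕ → ℚ
    F s = choose (toℕ i) (m ∸ s) * choose s (m ∸ toℕ j)
    F≡0 : ∀ s → s < (m ∸ toℕ i) ⊔ (m ∸ toℕ j) → F s ≡ 0ℚ
    F≡0 s s<lo = x≡0⊎y≡0⇒x*y≡0 (⊎.map (choose-vanish ∘ o<m∸n⇒n<m∸o (toℕ≤m i)) choose-vanish (<-⊔⁻ s<lo))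
    regroup : ∀ x a b → x * (a * b) ≡ a * (b * x)
    regroup = solve-∀ ℚ-ring
    term : ∀ k → sign (m ∸ toℕ j) * F (toℕ k) ≡ Fdown m i k * (signedPascal · exchange) k j
    term k = begin
      sign (m ∸ toℕ j) * (choose (toℕ i) (m ∸ toℕ k) * choose (toℕ k) (m ∸ toℕ j))
        ≡⟨ regroup (sign (m ∸ toℕ j)) (choose (toℕ i) (m ∸ toℕ k)) (choose (toℕ k) (m ∸ toℕ j)) ⟩
      choose (toℕ i) (m ∸ toℕ k) * (choose (toℕ k) (m ∸ toℕ j) * sign (m ∸ toℕ j))
        ≡⟨ cong₂ _*_ (Fdown-entry i k) (cong (λ b → choose (toℕ k) b * sign b) (opposite-prop j)) ⟨
      Fdown m i k * signedPascal k (opposite j)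
        ≡⟨ cong (Fdown m i k *_) (·-exchange signedPascal k j) ⟨
      Fdown m i k * (signedPascal · exchange) k j ∎

  Fdown→Hup : (λ i j → sign (m ∸ toℕ j) * sumRange 0 ((m ∸ toℕ i) ⊓ (m ∸ toℕ j))
                 (λ s → choose (m ∸ toℕ i) s * choose (m ∸ s) (toℕ j)))
              ≈ Hup m · (exchange · (signs · signedPascal))
  Fdown→Hup i j =
    trans (cong (sign (m ∸ toℕ j) *_) (sumRange-upTo m _ F (ℕ.≤-trans (ℕ.m⊓n≤m _ _) (ℕ.m∸n≤m m (toℕ i))) F≡0))
          (∑-scale (sign (m ∸ toℕ j)) term)
    where
    F : ℕ → ℚ
    F s = choose (m ∸ toℕ i) s * choose (m ∸ s) (toℕ j)
    F≡0 : ∀ s → (m ∸ toℕ i) ⊓ (m ∸ toℕ j) < s → s ≤ m → F s ≡ 0ℚ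
    F≡0 s hi<s s≤m = x≡0⊎y≡0⇒x*y≡0 (⊎.map choose-vanish (choose-vanish ∘ m∸n<o⇒m∸o<n (toℕ≤m j) s≤m) (⊓-<⁻ hi<s))
    regroup : ∀ x a y b z → x * a * (y * x * (b * z)) ≡ x * x * (y * z * (a * b))
    regroup = solve-∀ ℚ-ring
    term : ∀ k → sign (m ∸ toℕ j) * F (toℕ k) ≡ Hup m i k * (exchange · (signs · signedPascal)) k j
    term k = sym (begin
      Hup m i k * (exchange · (signs · signedPascal)) k j
        ≡⟨ cong (Hup m i k *_) (trans (exchange-· (signs · signedPascal) k j) (signs-· signedPascal (opposite k) j)) ⟩
      Hup m i k * (sign (toℕ (opposite k)) * (choose (toℕ (opposite k)) (toℕ j) * sign (toℕ j)))
        ≡⟨ cong (λ a → Hup m i k * (sign a * (choose a (toℕ j) * sign (toℕ j)))) (opposite-prop k) ⟩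
      sign (toℕ k) * A * (sign (m ∸ toℕ k) * (B * sign (toℕ j)))
        ≡⟨ cong (λ x → sign (toℕ k) * A * (x * (B * sign (toℕ j)))) (sign-∸ (toℕ≤m k)) ⟩
      sign (toℕ k) * A * (sign m * sign (toℕ k) * (B * sign (toℕ j)))
        ≡⟨ regroup (sign (toℕ k)) A (sign m) B (sign (toℕ j)) ⟩
      sign (toℕ k) * sign (toℕ k) * (sign m * sign (toℕ j) * (A * B))
        ≡⟨ cong₂ (λ x y → x * (y * (A * B))) (sign-squared (toℕ k)) (sym (sign-∸ (toℕ≤m j))) ⟩
      1ℚ * (sign (m ∸ toℕ j) * (A * B))
        ≡⟨ ℚ.*-identityˡ (sign (m ∸ toℕ j) * (A * B)) ⟩
      sign (m ∸ toℕ j) * (A * B) ∎)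
      where
      A = choose (m ∸ toℕ i) (toℕ k)
      B = choose (m ∸ toℕ k) (toℕ j)

  Hbullet→Fup : (λ i j → sumRange 0 (toℕ i ⊓ toℕ j) (λ s → choose (toℕ i) s * choose (m ∸ s) (m ∸ toℕ j)))
                ≈ Fup m · ((exchange · pascal) · exchange)
  Hbullet→Fup i j =
    trans (sumRange-upTo m _ F (ℕ.≤-trans (ℕ.m⊓n≤m _ _) (toℕ≤m i)) F≡0) (sum-cong-≗ term)
    where
    F : ℕ → ℚ
    F s = choose (toℕ i) s * choose (m ∸ s) (m ∸ toℕ j)
    F≡0 : ∀ s → toℕ i ⊓ toℕ j < s → s ≤ m → F s ≡ 0ℚ
    F≡0 s hi<s s≤m = x≡0⊎y≡0⇒x*y≡0 (⊎.map choose-vanish (λ j<s → choose-vanish (ℕ.∸-monoʳ-< j<s s≤m)) (⊓-<⁻ hi<s))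
    term : ∀ k → F (toℕ k) ≡ Fup m i k * ((exchange · pascal) · exchange) k j
    term k = cong (choose (toℕ i) (toℕ k) *_) (sym (begin
      ((exchange · pascal) · exchange) k j          ≡⟨ ·-exchange (exchange · pascal) k j ⟩
      (exchange · pascal) k (opposite j)            ≡⟨ exchange-· pascal k (opposite j) ⟩
      pascal (opposite k) (opposite j)              ≡⟨ cong₂ choose (opposite-prop k) (opposite-prop j) ⟩
      choose (m ∸ toℕ k) (m ∸ toℕ j)                ∎))

  Fup→Hbullet : (λ i j → sign (toℕ i Data.Nat.+ toℕ j) * sumRange (toℕ i ⊔ toℕ j) m
                   (λ s → choose (m ∸ toℕ i) (m ∸ s) * choose s (toℕ j)))
                ≈ Hbullet m · (signs · signedPascal)
  Fup→Hbullet i j =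
    trans (cong (sign (toℕ i Data.Nat.+ toℕ j) *_) (sumRange-from m _ F (ℕ.⊔-lub (toℕ≤m i) (toℕ≤m j)) F≡0))
          (∑-scale (sign (toℕ i Data.Nat.+ toℕ j)) term)
    where
    F : ℕ → ℚ
    F s = choose (m ∸ toℕ i) (m ∸ s) * choose s (toℕ j)
    F≡0 : ∀ s → s < toℕ i ⊔ toℕ j → F s ≡ 0ℚ
    F≡0 s s<lo = x≡0⊎y≡0⇒x*y≡0 (⊎.map (λ s<i → choose-vanish (ℕ.∸-monoʳ-< s<i (toℕ≤m i))) choose-vanish (<-⊔⁻ s<lo))
    regroup : ∀ x y z a b → x * y * (a * b) * (z * z) ≡ x * z * a * (z * (b * y))
    regroup = solve-∀ ℚ-ring
    term : ∀ k → sign (toℕ i Data.Nat.+ toℕ j) * F (toℕ k) ≡ Hbullet m i k * (signs · signedPascal) k j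
    term k = begin
      sign (toℕ i Data.Nat.+ toℕ j) * (A * B)
        ≡⟨ cong (_* (A * B)) (sign-+ (toℕ i) (toℕ j)) ⟩
      sign (toℕ i) * sign (toℕ j) * (A * B)
        ≡⟨ ℚ.*-identityʳ _ ⟨
      sign (toℕ i) * sign (toℕ j) * (A * B) * 1ℚ
        ≡⟨ cong (sign (toℕ i) * sign (toℕ j) * (A * B) *_) (sign-squared (toℕ k)) ⟨
      sign (toℕ i) * sign (toℕ j) * (A * B) * (sign (toℕ k) * sign (toℕ k))
        ≡⟨ regroup (sign (toℕ i)) (sign (toℕ j)) (sign (toℕ k)) A B ⟩
      sign (toℕ i) * sign (toℕ k) * A * (sign (toℕ k) * (B * sign (toℕ j)))
        ≡⟨ cong₂ _*_ (Hbullet-entry i k) (signs-· signedPascal k j) ⟨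
      Hbullet m i k * (signs · signedPascal) k j ∎
      where
      A = choose (m ∸ toℕ i) (m ∸ toℕ k)
      B = choose (toℕ k) (toℕ j)

mainTheorem5 : (m : ℕ) → 1 ≤ m →
    IsChangeOfBasis (Hup m) (Fdown m)
      (λ i j → sgn (+ (m ∸ toℕ j)) *
        sumRange ((m ∸ toℕ i) ⊔ (m ∸ toℕ j)) m
          (λ s → binom (toℕ i) (+ (m ∸ s)) * binom s (+ (m ∸ toℕ j))))
    × IsChangeOfBasis (Fdown m) (Hup m)
      (λ i j → sgn (+ (m ∸ toℕ j)) *
        sumRange 0 ((m ∸ toℕ i) ⊓ (m ∸ toℕ j))
          (λ s → binom (m ∸ toℕ i) (+ s) * binom (m ∸ s) (+ toℕ j)))
    × IsChangeOfBasis (Hbullet m) (Fup m)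
      (λ i j →
        sumRange 0 (toℕ i ⊓ toℕ j)
          (λ s → binom (toℕ i) (+ s) * binom (m ∸ s) (+ (m ∸ toℕ j))))
    × IsChangeOfBasis (Fup m) (Hbullet m)
      (λ i j → sgn (+ (toℕ i Data.Nat.+ toℕ j)) *
        sumRange (toℕ i ⊔ toℕ j) m
          (λ s → binom (m ∸ toℕ i) (+ (m ∸ s)) * binom s (+ toℕ j)))
mainTheorem5 m _ =
    changeOfBasis (Hup-inverse m) (Hup→Fdown m)
  , changeOfBasis (Fdown-inverse m) (Fdown→Hup m)
  , changeOfBasis (Hbullet-inverse m) (Hbullet→Fup m)
  , changeOfBasis pascal-inverse (Fup→Hbullet m)
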